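{- Let $w\in\{a,\alpha\}^*$ be the normalized name of a morphism, and suppose $w$ starts with the letter $a$. Then the normalized name $N(wb)$ has prefix $b$ and suffix $a$, the word $v=b^{ -1}N(wb)$ (i.e. $N(wb)$ with its first letter removed) belongs to $\{a,\beta\}^*$, and $|v|_\beta=|w|_\alpha$.
   Context: Words over $\{a,b,\alpha,\beta\}$ are subject to the rewriting rules $\alpha a^k\beta=\beta b^k\alpha$ and $a\alpha^kb=b\beta^ka$ for all $k\in\mathbb N$ (these preserve positions of Latin letters $a,b$ and Greek letters $\alpha,\beta$). With $a<b$ and $\alpha<\beta$, $N(u)$ denotes the lexicographically greatest word obtainable from $u$ by these rules; $u$ is a normalized name if $N(u)=u$. $|v|_x$ denotes the number of occurrences of the letter $x$ in $v$. -}

module Defs where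

open import Data.Nat using (ℕ; zero; suc; _<_)
open import Data.List using (List; []; _∷_; _++_; replicate; length)
open import Data.Product using (Σ; _×_; _,_)
open import Data.Sum using (_⊎_)
open import Relation.Binary.PropositionalEquality using (_≡_)
open import Relation.Binary.Construct.Closure.Equivalence using (EqClosure)

data Letter : Set where
  a b α β : Letter

Word : Set
Word = List Letter

-- Rank used for the letter order: a < b and α < β.
-- (Latin and Greek letters are never compared in practice, since the rules
--  preserve the positions of Latin/Greek letters; the choice a<b<α<β is irrelevant.)
rank : Letter → ℕ
rank a = 0
rank b = 1
rank α = 2
rank β = 3

data _≤L_ : Word → Word → Set where
  []≤    : ∀ {v} → [] ≤L v
  here≤  : ∀ {x y u v} → rank x < rank y → (x ∷ u) ≤L (y ∷ v)
  there≤ : ∀ {x u v} → u ≤L v → (x ∷ u) ≤L (x ∷ v)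

data Rule : Word → Word → Set where
  rule₁ : ∀ k → Rule (α ∷ replicate k a ++ β ∷ []) (β ∷ replicate k b ++ α ∷ [])
  rule₂ : ∀ k → Rule (a ∷ replicate k α ++ b ∷ []) (b ∷ replicate k β ++ a ∷ [])

data Step : Word → Word → Set where
  step : ∀ p s {l r} → Rule l r → Step (p ++ l ++ s) (p ++ r ++ s)

_~_ : Word → Word → Set
_~_ = EqClosure Step

IsN : Word → Word → Set
IsN u v = (u ~ v) × (∀ v' → u ~ v' → v' ≤L v)

Normalized : Word → Set
Normalized u = IsN u u

eqL : Letter → Letter → ℕ
eqL a a = 1
eqL b b = 1
eqL α α = 1
eqL β β = 1
eqL _ _ = 0

count : Letter → Word → ℕ
count x [] = 0
count x (y ∷ v) = eqL x y Data.Nat.+ count x v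

-- Let  Split  be the language  {a,α}* b {a,β}*.  The proof rests on two
-- invariants of the rewriting relation _~_:
--   * the Latin/Greek pattern ("shape") of a word is preserved by every rule;
--   * Split is closed under rewriting steps in both directions: inside a
--     Split word the only possible redex is  a α^k b ↦ b β^k a  (or its
--     reverse), and applying it keeps the word in Split.
-- Every Split word either contains a factor  a α^k b  or has the form
-- α^k b s  with  s ∈ {a,β}*.  A lexicographically maximal word cannot contain
-- a α^k b, since rewriting it to  b β^k a  gives a larger word.  Hence
-- z = N(wb) = α^k b s;  comparing shapes with  wb  (which starts with the Latin
-- letter a) forces k = 0.  Writing  w = a w',  the shape of  s  is then the
-- shape of  w'  followed by a Latin letter.  Since  s ∈ {a,β}*, its last letter
-- is therefore  a, and its β's sit exactly where  w'  has α's.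
module Submission where

open import Defs
open import Data.List using (List; []; _∷_; _++_)
open import Data.List.Relation.Unary.All using (All)
open import Data.Product using (Σ; _×_; _,_)
open import Data.Sum using (_⊎_)
open import Relation.Binary.PropositionalEquality using (_≡_)

open import Data.Nat using (ℕ; zero; suc)
open import Data.Nat.Properties using (<-irrefl)
open import Data.Bool using (Bool; true; false)
open import Data.List using (replicate; map; _∷ʳ_)
open import Data.List.Properties using (map-++; ∷-injectiveʳ)
open import Data.List.Relation.Unary.All using ([]; _∷_)
open import Data.List.Relation.Unary.All.Properties using (++⁻ʳ)
open import Data.Sum using (inj₁; inj₂)
open import Data.Product using (proj₁; proj₂)
open import Data.Empty using (⊥-elim)
open import Function.Bundles using (_⇔_; mk⇔; Equivalence)
open import Function.Properties.Equivalence using (⇔-isEquivalence)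
open import Relation.Nullary using (¬_)
open import Relation.Binary.PropositionalEquality
  using (refl; sym; trans; cong; cong₂; isEquivalence; module ≡-Reasoning)
open import Relation.Binary.Construct.Closure.Equivalence using (gfold; return)
open import Relation.Binary.Construct.Closure.ReflexiveTransitive using (_◅◅_)

AorAlpha : Letter → Set
AorAlpha x = (x ≡ a) ⊎ (x ≡ α)

AorBeta : Letter → Set
AorBeta x = (x ≡ a) ⊎ (x ≡ β)

data Tail : Word → Set where
  []  : Tail []
  a∷_ : ∀ {u} → Tail u → Tail (a ∷ u)
  β∷_ : ∀ {u} → Tail u → Tail (β ∷ u)

data Split : Word → Set where
  b∷_ : ∀ {u} → Tail u → Split (b ∷ u)
  a∷_ : ∀ {u} → Split u → Split (a ∷ u)
  α∷_ : ∀ {u} → Split u → Split (α ∷ u)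

Tail⇒All : ∀ {u} → Tail u → All AorBeta u
Tail⇒All []      = []
Tail⇒All (a∷ t) = inj₁ refl ∷ Tail⇒All t
Tail⇒All (β∷ t) = inj₂ refl ∷ Tail⇒All t

split-wb : ∀ w → All AorAlpha w → Split (w ++ b ∷ [])
split-wb []      []                = b∷ []
split-wb (_ ∷ w) (inj₁ refl ∷ all) = a∷ split-wb w all
split-wb (_ ∷ w) (inj₂ refl ∷ all) = α∷ split-wb w all


latin : Letter → Bool
latin a = true
latin b = true
latin α = false
latin β = false

shape : Word → List Bool
shape = map latin

-- Both rules are of the form  x y^k z ↔ x' y'^k z'  with x,x' (y,y' and
-- z,z') of the same kind, so the two sides have equal shape.
shape-pattern : ∀ {y y' z z'} k → latin y ≡ latin y' → latin z ≡ latin z'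
  → shape (replicate k y ++ z ∷ []) ≡ shape (replicate k y' ++ z' ∷ [])
shape-pattern zero    _  ez = cong (_∷ []) ez
shape-pattern (suc k) ey ez = cong₂ _∷_ ey (shape-pattern k ey ez)

shape-rule : ∀ {l r} → Rule l r → shape l ≡ shape r
shape-rule (rule₁ k) = cong (false ∷_) (shape-pattern k refl refl)
shape-rule (rule₂ k) = cong (true ∷_) (shape-pattern k refl refl)

shape-step : ∀ {u v} → Step u v → shape u ≡ shape v
shape-step (step p s {l} {r} ru) = begin
  shape (p ++ l ++ s)           ≡⟨ map-++ latin p (l ++ s) ⟩
  shape p ++ shape (l ++ s)     ≡⟨ cong (shape p ++_) (map-++ latin l s) ⟩
  shape p ++ shape l ++ shape s ≡⟨ cong (λ t → shape p ++ t ++ shape s) (shape-rule ru) ⟩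
  shape p ++ shape r ++ shape s ≡⟨ cong (shape p ++_) (map-++ latin r s) ⟨
  shape p ++ shape (r ++ s)     ≡⟨ map-++ latin p (r ++ s) ⟨
  shape (p ++ r ++ s)           ∎
  where open ≡-Reasoning

shape-invariant : ∀ {u v} → u ~ v → shape u ≡ shape v
shape-invariant = gfold isEquivalence shape shape-step


Tail-suffix : ∀ p {q} → Tail (p ++ q) → Tail q
Tail-suffix []      t       = t
Tail-suffix (_ ∷ p) (a∷ t) = Tail-suffix p t
Tail-suffix (_ ∷ p) (β∷ t) = Tail-suffix p t

-- No side of a rule can start a {a,β}-word: each side begins with α or b,
-- or with a β or a followed by α or b.
Tail-no-lhs : ∀ {l r} s → Rule l r → ¬ Tail (l ++ s)
Tail-no-lhs s (rule₁ k) ()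
Tail-no-lhs s (rule₂ zero) (a∷ ())
Tail-no-lhs s (rule₂ (suc k)) (a∷ ())

Tail-no-rhs : ∀ {l r} s → Rule l r → ¬ Tail (r ++ s)
Tail-no-rhs s (rule₁ zero) (β∷ ())
Tail-no-rhs s (rule₁ (suc k)) (β∷ ())
Tail-no-rhs s (rule₂ k) ()

Split-αᵏb⁻ : ∀ k s → Split ((replicate k α ++ b ∷ []) ++ s) → Tail s
Split-αᵏb⁻ zero    s (b∷ t) = t
Split-αᵏb⁻ (suc k) s (α∷ g) = Split-αᵏb⁻ k s g

Split-αᵏb : ∀ k s → Tail s → Split ((replicate k α ++ b ∷ []) ++ s)
Split-αᵏb zero    s t = b∷ t
Split-αᵏb (suc k) s t = α∷ Split-αᵏb k s t

Tail-βᵏa⁻ : ∀ k s → Tail ((replicate k β ++ a ∷ []) ++ s) → Tail s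
Tail-βᵏa⁻ zero    s (a∷ t) = t
Tail-βᵏa⁻ (suc k) s (β∷ t) = Tail-βᵏa⁻ k s t

Tail-βᵏa : ∀ k s → Tail s → Tail ((replicate k β ++ a ∷ []) ++ s)
Tail-βᵏa zero    s t = a∷ t
Tail-βᵏa (suc k) s t = β∷ Tail-βᵏa k s t

Split-no-aᵏβ : ∀ k s → ¬ Split ((replicate k a ++ β ∷ []) ++ s)
Split-no-aᵏβ zero    s ()
Split-no-aᵏβ (suc k) s (a∷ g) = Split-no-aᵏβ k s g

Split-rule : ∀ {l r} s → Rule l r → Split (l ++ s) → Split (r ++ s)
Split-rule s (rule₁ k) (α∷ g) = ⊥-elim (Split-no-aᵏβ k s g)
Split-rule s (rule₂ k) (a∷ g) = b∷ Tail-βᵏa k s (Split-αᵏb⁻ k s g)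

Split-rule⁻ : ∀ {l r} s → Rule l r → Split (r ++ s) → Split (l ++ s)
Split-rule⁻ s (rule₁ k) ()
Split-rule⁻ s (rule₂ k) (b∷ t) = a∷ Split-αᵏb k s (Tail-βᵏa⁻ k s t)

-- Rewriting anywhere: a redex cannot lie inside the {a,β}-tail.
Split-step : ∀ {u v} → Step u v → Split u → Split v
Split-step (step [] s ru) g = Split-rule s ru g
Split-step (step (_ ∷ p) s ru) (b∷ t) = ⊥-elim (Tail-no-lhs s ru (Tail-suffix p t))
Split-step (step (_ ∷ p) s ru) (a∷ g) = a∷ Split-step (step p s ru) g
Split-step (step (_ ∷ p) s ru) (α∷ g) = α∷ Split-step (step p s ru) g

Split-step⁻ : ∀ {u v} → Step u v → Split v → Split u
Split-step⁻ (step [] s ru) g = Split-rule⁻ s ru g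
Split-step⁻ (step (_ ∷ p) s ru) (b∷ t) = ⊥-elim (Tail-no-rhs s ru (Tail-suffix p t))
Split-step⁻ (step (_ ∷ p) s ru) (a∷ g) = a∷ Split-step⁻ (step p s ru) g
Split-step⁻ (step (_ ∷ p) s ru) (α∷ g) = α∷ Split-step⁻ (step p s ru) g

Split-invariant : ∀ {u v} → u ~ v → Split u ⇔ Split v
Split-invariant = gfold ⇔-isEquivalence Split
  (λ st → mk⇔ (Split-step st) (Split-step⁻ st))


Split-decompose : ∀ {u} → Split u
  → (Σ ℕ λ k → Σ Word λ s → (u ≡ (replicate k α ++ b ∷ []) ++ s) × Tail s)
  ⊎ (Σ Word λ p → Σ ℕ λ k → Σ Word λ s → u ≡ p ++ (a ∷ replicate k α ++ b ∷ []) ++ s)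
Split-decompose (b∷ t) = inj₁ (zero , _ , refl , t)
Split-decompose (a∷ g) with Split-decompose g
... | inj₁ (k , s , refl , _) = inj₂ ([] , k , s , refl)
... | inj₂ (p , k , s , refl) = inj₂ (a ∷ p , k , s , refl)
Split-decompose (α∷ g) with Split-decompose g
... | inj₁ (k , s , refl , t) = inj₁ (suc k , s , refl , t)
... | inj₂ (p , k , s , refl) = inj₂ (α ∷ p , k , s , refl)

b-beats-a : ∀ p {x y} → ¬ ((p ++ b ∷ x) ≤L (p ++ a ∷ y))
b-beats-a []      (here≤ ())
b-beats-a (_ ∷ p) (here≤ lt) = <-irrefl refl lt
b-beats-a (_ ∷ p) (there≤ le) = b-beats-a p le

-- A normal form contains no factor  a α^k b: rewriting it would increase it.
normal-form-no-redex : ∀ {u} p k s → ¬ IsN u (p ++ (a ∷ replicate k α ++ b ∷ []) ++ s)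
normal-form-no-redex p k s (u~z , maximal) =
  b-beats-a p (maximal _ (u~z ◅◅ return (step p s (rule₂ k))))


shape-snoc⁻ : ∀ v t {y} → shape v ≡ t ∷ʳ y
  → Σ Word λ u → Σ Letter λ x → (v ≡ u ∷ʳ x) × (latin x ≡ y)
shape-snoc⁻ (x ∷ []) []      refl = [] , x , refl , refl
shape-snoc⁻ (x ∷ v)  (_ ∷ t) e with shape-snoc⁻ v t (∷-injectiveʳ e)
... | u , y , refl , ly = x ∷ u , y , refl , ly

Tail-ends-with-a : ∀ {v} t → Tail v → shape v ≡ t ∷ʳ true → Σ Word λ u → v ≡ u ∷ʳ a
Tail-ends-with-a {v} t tv e with shape-snoc⁻ v t e
... | u , x , refl , lx with ++⁻ʳ u (Tail⇒All tv)
... | inj₁ refl ∷ [] = u , refl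
Tail-ends-with-a t tv e | u , β , refl , () | _

greeks : List Bool → ℕ
greeks []          = 0
greeks (true ∷ t)  = greeks t
greeks (false ∷ t) = suc (greeks t)

greeks-snoc-latin : ∀ t → greeks (t ∷ʳ true) ≡ greeks t
greeks-snoc-latin []          = refl
greeks-snoc-latin (true ∷ t)  = greeks-snoc-latin t
greeks-snoc-latin (false ∷ t) = cong suc (greeks-snoc-latin t)

count-greek : ∀ g v → latin g ≡ false → All (λ x → (x ≡ a) ⊎ (x ≡ g)) v
  → count g v ≡ greeks (shape v)
count-greek g []      _  []                = refl
count-greek α (_ ∷ v) lg (inj₁ refl ∷ all) = count-greek α v lg all
count-greek α (_ ∷ v) lg (inj₂ refl ∷ all) = cong suc (count-greek α v lg all)
count-greek β (_ ∷ v) lg (inj₁ refl ∷ all) = count-greek β v lg all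
count-greek β (_ ∷ v) lg (inj₂ refl ∷ all) = cong suc (count-greek β v lg all)

-- The argument does not use the hypothesis that  w  itself is normalized.
mainTheorem11 : (w : Word) → All (λ x → (x ≡ a) ⊎ (x ≡ α)) w → Normalized w
    → Σ Word (λ w' → w ≡ a ∷ w')
    → (z : Word) → IsN (w ++ b ∷ []) z
    → Σ Word (λ v → (z ≡ b ∷ v)
    × Σ Word (λ u → z ≡ u ++ a ∷ [])
    × All (λ x → (x ≡ a) ⊎ (x ≡ β)) v
    × (count β v ≡ count α w))
mainTheorem11 w all-w@(_ ∷ all-w') _ (w' , refl) z N@(wb~z , _)
  with Split-decompose (Equivalence.to (Split-invariant wb~z) (split-wb w all-w))
     | shape-invariant wb~z
... | inj₂ (p , k , s , refl) | _  = ⊥-elim (normal-form-no-redex p k s N)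
... | inj₁ (suc k , s , refl , _) | ()   -- wb starts with a Latin letter, z with α
... | inj₁ (zero , s , refl , tail-s) | shape-wb≡shape-z =
  s , refl , (b ∷ u , cong (b ∷_) s≡ua) , Tail⇒All tail-s , greek-count
  where
  shape-s : shape s ≡ shape w' ∷ʳ true
  shape-s = trans (∷-injectiveʳ (sym shape-wb≡shape-z)) (map-++ latin w' (b ∷ []))

  s-ends-with-a : Σ Word λ u → s ≡ u ∷ʳ a
  s-ends-with-a = Tail-ends-with-a (shape w') tail-s shape-s

  u : Word
  u = proj₁ s-ends-with-a

  s≡ua : s ≡ u ∷ʳ a
  s≡ua = proj₂ s-ends-with-a

  greek-count : count β s ≡ count α (a ∷ w')
  greek-count = begin
    count β s                 ≡⟨ count-greek β s refl (Tail⇒All tail-s) ⟩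
    greeks (shape s)          ≡⟨ cong greeks shape-s ⟩
    greeks (shape w' ∷ʳ true) ≡⟨ greeks-snoc-latin (shape w') ⟩
    greeks (shape w')         ≡⟨ count-greek α w' refl all-w' ⟨
    count α w'                ∎
    where open ≡-Reasoning
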